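{- For any SDS $K\subseteq\mathcal P(\mathcal T)$: (i) $K$ is finitely consistent if and only if $E(\mathcal W)=\{D\in\overline{\mathbf D}:\mathcal W\subseteq K_D\}\neq\emptyset$ for all finite $\mathcal W\subseteq K$; (ii) $\mathrm{cl}_{\mathrm{fin}}(K)=\bigcup_{\mathcal W\subseteq K,\ \mathcal W\text{ finite}}\ \bigcap_{D\in\overline{\mathbf D}:\ \mathcal W\subseteq K_D}K_D$; (iii) $K$ is finitely coherent if and only if $K$ is finitely consistent and $K=\bigcup_{\mathcal W\subseteq K,\ \mathcal W\text{ finite}}\ \bigcap_{D\in\overline{\mathbf D}:\ \mathcal W\subseteq K_D}K_D$.
   Context: Let $\mathcal T$ be a non-empty set (of "things"), $\mathrm{cl}:\mathcal P(\mathcal T)\to\mathcal P(\mathcal T)$ a closure operator (extensive, monotone, idempotent), $\mathcal T_-\subseteq\mathcal T$ a set of forbidden things, $\mathcal T_+:=\mathrm{cl}(\emptyset)$, with standing assumption $\mathcal T_+\cap\mathcal T_-=\emptyset$. A coherent SDT is a $D\subseteq\mathcal T$ with $\mathrm{cl}(D)=D$ and $D\cap\mathcal T_-=\emptyset$; $\overline{\mathbf D}$ is the set of all coherent SDTs. For $\mathcal W\subseteq\mathcal P(\mathcal T)$, $\Sigma_{\mathcal W}$ is the set of maps $\sigma:\mathcal W\to\mathcal T$ with $\sigma(S)\in S$ for all $S\in\mathcal W$, and $\sigma(\mathcal W):=\{\sigma(S):S\in\mathcal W\}$. An SDS is any $K\subseteq\mathcal P(\mathcal T)$. It is finitely coherent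 if (K1) $\emptyset\notin K$; (K2) if $S_1\in K$ and $S_1\subseteq S_2\subseteq\mathcal T$ then $S_2\in K$; (K3) if $S\in K$ then $S\setminus\mathcal T_-\in K$; (K4) $\{t\}\in K$ for all $t\in\mathcal T_+$; (K5fin) for every non-empty finite $\mathcal W\subseteq K$ and every family $(t_\sigma)_{\sigma\in\Sigma_{\mathcal W}}$ with $t_\sigma\in\mathrm{cl}(\sigma(\mathcal W))$, $\{t_\sigma:\sigma\in\Sigma_{\mathcal W}\}\in K$. An SDS is finitely consistent if it is included in some finitely coherent SDS. $\mathrm{cl}_{\mathrm{fin}}(K)$ is the intersection of all finitely coherent SDSes that include $K$, which equals $\mathcal P(\mathcal T)$ if there are none. For $D\subseteq\mathcal T$ let $K_D:=\{S\subseteq\mathcal T:S\cap D\neq\emptyset\}$. For $S\subseteq\mathcal T$ let $\overline{\mathbf D}_S:=\{D\in\overline{\mathbf D}:S\cap D\neq\emptyset\}$ and for $\mathcal W\subseteq\mathcal P(\mathcal T)$ let $E(\mathcal W):=\bigcap_{S\in\mathcal W}\overline{\mathbf D}_S$ (with $E(\emptyset)=\overline{\mathbf D}$). An intersection over an empty family of $K_D$'s is taken to be $\mathcal P(\mathcal T)$. -}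

module Defs where

open import Level using (0ℓ)
open import Data.Nat using (ℕ; suc)
open import Data.Fin using (Fin)
open import Data.Product using (Σ; ∃; _×_; _,_)
open import Data.Empty using (⊥)
open import Relation.Nullary using (¬_)
open import Relation.Unary using (Pred; _⊆_; _≐_; ∅)
open import Relation.Binary.PropositionalEquality using (_≡_)

record ClosureSetting : Set₁ where
  field
    Thing      : Set
    nonEmpty   : Thing
    cl         : Pred Thing 0ℓ → Pred Thing 0ℓ
    extensive  : ∀ (A : Pred Thing 0ℓ) → A ⊆ cl A
    monotone   : ∀ (A B : Pred Thing 0ℓ) → A ⊆ B → cl A ⊆ cl B
    idempotent : ∀ (A : Pred Thing 0ℓ) → cl (cl A) ≐ cl A
    Forbidden  : Pred Thing 0ℓ
    standing   : ∀ (t : Thing) → cl ∅ t → Forbidden t → ⊥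

module Notions (C : ClosureSetting) where
  open ClosureSetting C

  Subset : Set₁
  Subset = Pred Thing 0ℓ

  SDS : Set₁
  SDS = Pred Subset 0ℓ

  T₊ : Subset
  T₊ = cl ∅

  singleton : Thing → Subset
  singleton t = λ x → x ≡ t

  minusForbidden : Subset → Subset
  minusForbidden S = λ t → S t × ¬ Forbidden t

  CoherentSDT : Subset → Set
  CoherentSDT D = (cl D ≐ D) × (∀ t → D t → Forbidden t → ⊥)

  KD : Subset → SDS
  KD D = λ S → ∃ λ t → S t × D t

  -- A finite family 𝒲 ⊆ 𝒫(𝒯) is given as an enumeration W : Fin n → Subset;
  -- the set 𝒲 is its image {W i : i}. (Entries that are equal as sets are
  -- the same element of 𝒲.)

  -- Σ_𝒲 : maps σ : 𝒲 → 𝒯 with σ(S) ∈ S. A map on the set 𝒲 must give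
  -- the same value on entries that are equal as sets.
  record Selection {n : ℕ} (W : Fin n → Subset) : Set where
    field
      pick     : Fin n → Thing
      pickIn   : ∀ i → W i (pick i)
      pickWell : ∀ i j → W i ≐ W j → pick i ≡ pick j

  image : ∀ {n} {W : Fin n → Subset} → Selection W → Subset
  image {n} σ = λ t → ∃ λ (i : Fin n) → Selection.pick σ i ≡ t

  record FinitelyCoherent (K : SDS) : Set₁ where
    field
      K1 : ¬ K ∅
      K2 : ∀ (S₁ S₂ : Subset) → K S₁ → S₁ ⊆ S₂ → K S₂
      K3 : ∀ (S : Subset) → K S → K (minusForbidden S)
      K4 : ∀ (t : Thing) → T₊ t → K (singleton t)
      K5fin : ∀ (n : ℕ) (W : Fin (suc n) → Subset) → (∀ i → K (W i)) →
              (tσ : Selection W → Thing) →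
              (∀ σ → cl (image σ) (tσ σ)) →
              K (λ x → ∃ λ (σ : Selection W) → tσ σ ≡ x)

  FinitelyConsistent : SDS → Set₁
  FinitelyConsistent K = ∃ λ (K′ : SDS) → FinitelyCoherent K′ × (K ⊆ K′)

  -- cl_fin(K): intersection of all finitely coherent SDSes including K
  -- (this is all of 𝒫(𝒯) if there are none)
  clFin : SDS → Pred Subset _
  clFin K = λ S → ∀ (K′ : SDS) → FinitelyCoherent K′ → K ⊆ K′ → K′ S

  Dbar : Subset → Pred Subset 0ℓ
  Dbar S = λ D → CoherentSDT D × KD D S

  E : ∀ {n} → (Fin n → Subset) → Pred Subset 0ℓ
  E W = λ D → CoherentSDT D × (∀ i → (Dbar (W i)) D)

  FinUnion : SDS → Pred Subset _
  FinUnion K = λ S →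
    ∃ λ (n : ℕ) → Σ (Fin n → Subset) λ W → (∀ i → K (W i)) ×
      (∀ (D : Subset) → CoherentSDT D → (∀ i → KD D (W i)) → KD D S)

-- Call S forced by a finite 𝒲 ⊆ K when every coherent D meeting all of 𝒲 meets S.
-- A forced S lies in every finitely coherent SDS containing K: for each selection σ
-- pick a point of cl(σ(𝒲)) that is forbidden or lies in S (if cl(σ(𝒲)) has no
-- forbidden point it is a coherent SDT meeting 𝒲), and apply (K5fin), (K3), (K2).
-- Conversely the forced sets form a finitely coherent SDS once ∅ is not forced,
-- since a coherent D meeting all of 𝒲 carries a selection σ with cl(σ(𝒲)) ⊆ D.
-- Excluded middle makes that SDS a small predicate again, by resizing.
module Submission where

open import Defs
open import Level using (0ℓ; suc)
open import Data.Nat using (ℕ; _+_; z≤n; s≤s)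
open import Data.Fin using (Fin; zero; _≤_) renaming (suc to fsuc)
open import Data.Fin.Properties using (≤-antisym)
open import Data.Product using (Σ; ∃; _×_; _,_; proj₁; proj₂)
open import Data.Sum using (_⊎_; inj₁; inj₂)
open import Data.Vec.Functional using (Vector; _++_)
open import Data.Vec.Functional.Relation.Unary.All using (All)
open import Data.Vec.Functional.Relation.Unary.All.Properties using (++⁺; ++⁻ˡ; ++⁻ʳ)
open import Function using (_∘_; id)
open import Function.Bundles using (_⇔_; mk⇔; Equivalence)
open import Function.Properties.Equivalence using () renaming (trans to ⇔-trans)
open import Relation.Binary.Core using (Rel)
open import Relation.Binary.Structures using (IsEquivalence)
open import Relation.Binary.PropositionalEquality using (_≡_; refl; cong)
open import Relation.Nullary using (¬_; Dec; yes; no; contradiction)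
open import Relation.Nullary.Decidable using (True; toWitness; fromWitness)
open import Relation.Unary using (Pred; Decidable; _⊆_; _≐_; ∅)
open import Relation.Unary.Properties using (≐-refl; ≐-sym; ≐-trans)
open import Axiom.ExcludedMiddle using (ExcludedMiddle)

∃-least : ∀ {n p} {P : Pred (Fin n) p} → Decidable P → ∃ P →
          ∃ λ j → P j × (∀ {k} → P k → j ≤ k)
∃-least {ℕ.suc n} P? (i , pi) with P? zero
... | yes p₀ = zero , p₀ , λ _ → z≤n
∃-least {ℕ.suc n} P? (zero , p₀) | no ¬p₀ = contradiction p₀ ¬p₀
∃-least {ℕ.suc n} {P = P} P? (fsuc i , pi) | no ¬p₀
  with ∃-least {P = P ∘ fsuc} (P? ∘ fsuc) (i , pi)
... | j , pj , least = fsuc j , pj , least′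
  where
  least′ : ∀ {k} → P k → fsuc j ≤ k
  least′ {zero}   p₀ = contradiction p₀ ¬p₀
  least′ {fsuc k} pk = s≤s (least pk)

module CanonicalIndex {a ℓ} {A : Set a} {_≈_ : Rel A ℓ} (isEquivalence : IsEquivalence _≈_)
                      (_≈?_ : ∀ x y → Dec (x ≈ y)) {n} (x : Vector A n) where
  open IsEquivalence isEquivalence renaming (refl to ≈-refl; sym to ≈-sym; trans to ≈-trans)

  private
    least-in-class : (i : Fin n) → ∃ λ j → x j ≈ x i × (∀ {k} → x k ≈ x i → j ≤ k)
    least-in-class i = ∃-least (λ k → x k ≈? x i) (i , ≈-refl)

  rep : Fin n → Fin n
  rep i = proj₁ (least-in-class i)

  rep-≈ : ∀ i → x (rep i) ≈ x i
  rep-≈ i = proj₁ (proj₂ (least-in-class i))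

  rep-cong : ∀ {i j} → x i ≈ x j → rep i ≡ rep j
  rep-cong {i} {j} xi≈xj = ≤-antisym
    (proj₂ (proj₂ (least-in-class i)) (≈-trans (rep-≈ j) (≈-sym xi≈xj)))
    (proj₂ (proj₂ (least-in-class j)) (≈-trans (rep-≈ i) xi≈xj))

module Resize {ℓ} (em : ExcludedMiddle ℓ) where

  resize : ∀ {a} {A : Set a} → Pred A ℓ → Pred A 0ℓ
  resize P x = True (em {P x})

  resize-≐ : ∀ {a} {A : Set a} (P : Pred A ℓ) → resize P ≐ P
  resize-≐ P = toWitness , fromWitness

module SDSTheory (C : ClosureSetting) where
  open ClosureSetting C
  open Notions C

  ≐-isEquivalence : IsEquivalence {A = Subset} _≐_
  ≐-isEquivalence = record { refl = ≐-refl ; sym = ≐-sym ; trans = ≐-trans }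

  T₊-coherent : CoherentSDT T₊
  T₊-coherent = idempotent ∅ , standing

  T₊⊆coherent : ∀ {D} → CoherentSDT D → T₊ ⊆ D
  T₊⊆coherent {D} (clD≐D , _) = proj₁ clD≐D ∘ monotone ∅ D λ ()

  FinitelyCoherent-resp-≐ : ∀ {K K′} → K ≐ K′ → FinitelyCoherent K → FinitelyCoherent K′
  FinitelyCoherent-resp-≐ (K⊆K′ , K′⊆K) coh = record
    { K1 = K1 ∘ K′⊆K
    ; K2 = λ S₁ S₂ k S₁⊆S₂ → K⊆K′ (K2 S₁ S₂ (K′⊆K k) S₁⊆S₂)
    ; K3 = λ S → K⊆K′ ∘ K3 S ∘ K′⊆K
    ; K4 = λ t → K⊆K′ ∘ K4 t
    ; K5fin = λ n W ks tσ tσ∈cl → K⊆K′ (K5fin n W (K′⊆K ∘ ks) tσ tσ∈cl)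
    }
    where open FinitelyCoherent coh

  values : ∀ {n} {W : Vector Subset n} → (Selection W → Thing) → Subset
  values tσ x = ∃ λ σ → tσ σ ≡ x

  -- FinUnion K S unfolds to ∃ n W → All K W × W ⊩ S.
  infix 4 _⊩_
  _⊩_ : ∀ {n} → Vector Subset n → Subset → Set₁
  W ⊩ S = ∀ D → CoherentSDT D → All (KD D) W → KD D S

  ⊩-++ˡ : ∀ {m n S} (V : Vector Subset m) {V′ : Vector Subset n} → V ⊩ S → V ++ V′ ⊩ S
  ⊩-++ˡ V V⊩S D c = V⊩S D c ∘ ++⁻ˡ (KD D) V

  ⊩-++ʳ : ∀ {m n S} (V : Vector Subset m) {V′ : Vector Subset n} → V′ ⊩ S → V ++ V′ ⊩ S
  ⊩-++ʳ V V′⊩S D c = V′⊩S D c ∘ ++⁻ʳ (KD D) V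

  cl-image-meets : ∀ {n} {W : Vector Subset n} (σ : Selection W) → All (KD (cl (image σ))) W
  cl-image-meets σ i = Selection.pick σ i , Selection.pickIn σ i , extensive _ (i , refl)

  module FinUnionOf (K : SDS) where

    ⊆-FinUnion : K ⊆ FinUnion K
    ⊆-FinUnion {x = S} k = 1 , (λ _ → S) , (λ _ → k) , λ _ _ meets → meets zero

    FinUnion-mono : ∀ {K′} → K ⊆ K′ → FinUnion K ⊆ FinUnion K′
    FinUnion-mono K⊆K′ (n , W , ks , W⊩S) = n , W , K⊆K′ ∘ ks , W⊩S

    FinUnion-upward : ∀ {S₁ S₂} → FinUnion K S₁ → S₁ ⊆ S₂ → FinUnion K S₂
    FinUnion-upward (n , W , ks , W⊩S) S₁⊆S₂ = n , W , ks , λ D c meets →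
      let t , t∈S , t∈D = W⊩S D c meets in t , S₁⊆S₂ t∈S , t∈D

    FinUnion-minusForbidden : ∀ {S} → FinUnion K S → FinUnion K (minusForbidden S)
    FinUnion-minusForbidden (n , W , ks , W⊩S) = n , W , ks , λ D c meets →
      let t , t∈S , t∈D = W⊩S D c meets in t , (t∈S , proj₂ c t t∈D) , t∈D

    FinUnion-T₊ : ∀ {t} → T₊ t → FinUnion K (singleton t)
    FinUnion-T₊ {t} t∈T₊ = 0 , (λ ()) , (λ ()) , λ D c _ → t , refl , T₊⊆coherent c t∈T₊

    FinUnion-All : ∀ {n} {W : Vector Subset n} → All (FinUnion K) W →
                   ∃ λ m → Σ (Vector Subset m) λ V → All K V × All (V ⊩_) W
    FinUnion-All {ℕ.zero} _ = 0 , (λ ()) , (λ ()) , λ ()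
    FinUnion-All {ℕ.suc n} us with us zero | FinUnion-All (us ∘ fsuc)
    ... | m , V , ks , V⊩W₀ | m′ , V′ , ks′ , V′⊩W′ = m + m′ , V ++ V′ , ++⁺ K ks ks′ , λ where
      zero     → ⊩-++ˡ V V⊩W₀
      (fsuc i) → ⊩-++ʳ V (V′⊩W′ i)

  module Choice (em : ExcludedMiddle 0ℓ) where

    selection-into : ∀ {n} {W : Vector Subset n} {D} → All (KD D) W →
                     Σ (Selection W) λ σ → image σ ⊆ D
    selection-into {W = W} meets = σ , λ { (i , refl) → proj₂ (proj₂ (meets (rep i))) }
      where
      -- Going through the least index of each ≐-class makes σ well defined on the set 𝒲.
      open CanonicalIndex ≐-isEquivalence (λ _ _ → em) W
      σ : Selection W
      σ = record
        { pick     = λ i → proj₁ (meets (rep i))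
        ; pickIn   = λ i → proj₁ (rep-≈ i) (proj₁ (proj₂ (meets (rep i))))
        ; pickWell = λ i j Wi≐Wj → cong (proj₁ ∘ meets) (rep-cong Wi≐Wj)
        }

    FinUnion-K5fin : ∀ K {n} (W : Vector Subset (ℕ.suc n)) → All (FinUnion K) W →
                     (tσ : Selection W → Thing) → (∀ σ → cl (image σ) (tσ σ)) →
                     FinUnion K (values tσ)
    FinUnion-K5fin K W us tσ tσ∈cl with FinUnionOf.FinUnion-All K us
    ... | m , V , ks , V⊩W = m , V , ks , λ D c meets →
      let σ , σ⊆D = selection-into (λ i → V⊩W i D c meets)
      in tσ σ , (σ , refl) , proj₁ (proj₁ c) (monotone (image σ) D σ⊆D (tσ∈cl σ))

    cl-image-forbidden-or : ∀ {n S} {W : Vector Subset n} → W ⊩ S → (σ : Selection W) →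
                            ∃ λ t → cl (image σ) t × (Forbidden t ⊎ S t)
    cl-image-forbidden-or W⊩S σ with em {∃ λ t → cl (image σ) t × Forbidden t}
    ... | yes (t , t∈cl , f) = t , t∈cl , inj₁ f
    ... | no noForbidden =
      let t , t∈S , t∈cl = W⊩S (cl (image σ)) coherent (cl-image-meets σ)
      in t , t∈cl , inj₂ t∈S
      where
      coherent : CoherentSDT (cl (image σ))
      coherent = idempotent (image σ) , λ t t∈cl f → noForbidden (t , t∈cl , f)

    FinUnion-⊆ : ∀ {K} → FinitelyCoherent K → FinUnion K ⊆ K
    FinUnion-⊆ coh {S} (ℕ.zero , W , _ , W⊩S) =
      let t , t∈S , t∈T₊ = W⊩S T₊ T₊-coherent (λ ())
      in K2 (singleton t) S (K4 t t∈T₊) λ { refl → t∈S }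
      where open FinitelyCoherent coh
    FinUnion-⊆ coh {S} (ℕ.suc n , W , ks , W⊩S) =
      K2 _ S (K3 _ (K5fin n W ks (proj₁ ∘ choice) (proj₁ ∘ proj₂ ∘ choice))) values⊆S
      where
      open FinitelyCoherent coh
      choice = cl-image-forbidden-or W⊩S
      values⊆S : minusForbidden (values (proj₁ ∘ choice)) ⊆ S
      values⊆S ((σ , refl) , notForbidden) with proj₂ (proj₂ (choice σ))
      ... | inj₁ f   = contradiction f notForbidden
      ... | inj₂ t∈S = t∈S

  module Classical (em₀ : ExcludedMiddle 0ℓ) (em₁ : ExcludedMiddle (suc 0ℓ)) (K : SDS) where
    open Choice em₀
    open Resize em₁
    open FinUnionOf K

    FinUnion₀ : SDS
    FinUnion₀ = resize (FinUnion K)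

    ⊆-FinUnion₀ : K ⊆ FinUnion₀
    ⊆-FinUnion₀ k = fromWitness (⊆-FinUnion k)

    FinUnion₀-coherent : ¬ FinUnion K ∅ → FinitelyCoherent FinUnion₀
    FinUnion₀-coherent ∅∉ = record
      { K1 = ∅∉ ∘ toWitness
      ; K2 = λ _ _ u S₁⊆S₂ → fromWitness (FinUnion-upward (toWitness u) S₁⊆S₂)
      ; K3 = λ _ → fromWitness ∘ FinUnion-minusForbidden ∘ toWitness
      ; K4 = λ _ → fromWitness ∘ FinUnion-T₊
      ; K5fin = λ _ W us tσ tσ∈cl → fromWitness (FinUnion-K5fin K W (toWitness ∘ us) tσ tσ∈cl)
      }

    consistent⇔∅∉FinUnion : FinitelyConsistent K ⇔ (¬ FinUnion K ∅)
    consistent⇔∅∉FinUnion = mk⇔ ∅∉FinUnion consistent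
      where
      ∅∉FinUnion : FinitelyConsistent K → ¬ FinUnion K ∅
      ∅∉FinUnion (K′ , coh , K⊆K′) = FinitelyCoherent.K1 coh ∘ FinUnion-⊆ coh ∘ FinUnion-mono K⊆K′

      consistent : ¬ FinUnion K ∅ → FinitelyConsistent K
      consistent ∅∉ = FinUnion₀ , FinUnion₀-coherent ∅∉ , ⊆-FinUnion₀

    ∅∉FinUnion⇔E-nonempty : (¬ FinUnion K ∅) ⇔
      (∀ (n : ℕ) (W : Fin n → Subset) → (∀ i → K (W i)) → ∃ λ D → E W D)
    ∅∉FinUnion⇔E-nonempty = mk⇔ E-nonempty ∅∉FinUnion
      where
      E-nonempty : ¬ FinUnion K ∅ → ∀ n (W : Fin n → Subset) → All K W → ∃ λ D → E W D
      E-nonempty ∅∉ n W ks with em₁ {∃ λ D → E W D}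
      ... | yes inE = inE
      ... | no ¬inE = contradiction (n , W , ks , W⊩∅) ∅∉
        where
        W⊩∅ : W ⊩ ∅
        W⊩∅ D c meets = contradiction (D , c , λ i → c , meets i) ¬inE

      ∅∉FinUnion : (∀ n (W : Fin n → Subset) → All K W → ∃ λ D → E W D) → ¬ FinUnion K ∅
      ∅∉FinUnion nonEmpty (n , W , ks , W⊩∅) =
        let D , c , inE = nonEmpty n W ks in proj₁ (proj₂ (W⊩∅ D c (proj₂ ∘ inE)))

    clFin≐FinUnion : clFin K ≐ FinUnion K
    clFin≐FinUnion = clFin⊆ , λ u K′ coh K⊆K′ → FinUnion-⊆ coh (FinUnion-mono K⊆K′ u)
      where
      clFin⊆ : clFin K ⊆ FinUnion K
      clFin⊆ S∈cl with em₁ {FinUnion K ∅}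
      ... | yes ∅∈ = FinUnion-upward ∅∈ λ ()
      ... | no  ∅∉ = toWitness (S∈cl FinUnion₀ (FinUnion₀-coherent ∅∉) ⊆-FinUnion₀)

    coherent⇔consistent-fixed : FinitelyCoherent K ⇔ (FinitelyConsistent K × (K ≐ FinUnion K))
    coherent⇔consistent-fixed = mk⇔ consistent-fixed coherent
      where
      consistent-fixed : FinitelyCoherent K → FinitelyConsistent K × (K ≐ FinUnion K)
      consistent-fixed coh = (K , coh , id) , ⊆-FinUnion , FinUnion-⊆ coh

      coherent : FinitelyConsistent K × (K ≐ FinUnion K) → FinitelyCoherent K
      coherent (consistent , K≐U) = FinitelyCoherent-resp-≐
        (≐-trans (resize-≐ (FinUnion K)) (≐-sym K≐U))
        (FinUnion₀-coherent (Equivalence.to consistent⇔∅∉FinUnion consistent))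

theorem6 : ExcludedMiddle 0ℓ → ExcludedMiddle (suc 0ℓ) →
    (C : ClosureSetting) → let open Notions C in
    (K : SDS) →
      (FinitelyConsistent K ⇔
        (∀ (n : ℕ) (W : Fin n → Subset) → (∀ i → K (W i)) → ∃ λ D → E W D))
      × (clFin K ≐ FinUnion K)
      × (FinitelyCoherent K ⇔ (FinitelyConsistent K × (K ≐ FinUnion K)))
theorem6 em₀ em₁ C K =
    ⇔-trans consistent⇔∅∉FinUnion ∅∉FinUnion⇔E-nonempty
  , clFin≐FinUnion
  , coherent⇔consistent-fixed
  where open SDSTheory.Classical C em₀ em₁ K
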